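{- Let $1\le s\le d/2$, $n\ge d+1$, and let $\mathcal F\subseteq\binom{[n]}{d+1}$ be an $s$-witness family with fixed witnesses $B_F$ ($F\in\mathcal F$), and $\mathcal B=\{B_F:F\in\mathcal F\}$. Suppose that for each $B\in\mathcal B$ we are given a family $\mathcal A_B$ of subsets of $[n]\setminus B$ of size at most $d+1-s$ that is intersecting, such that every $F\in\mathcal F$ with $B_F=B$ contains some $A\in\mathcal A_B$, and such that every $F\in\mathcal F$ with $B\subseteq F$ satisfies $A\cap F\ne\varnothing$ for all $A\in\mathcal A_B$. Let $\mathcal B_1$ be the set of $B\in\mathcal B$ such that $\mathcal A_B$ contains a singleton, and for $B\in\mathcal B_1$ let $x_B$ be the (unique) element with $\{x_B\}\in\mathcal A_B$; for such $B$ set $\mathcal F_B=\{F\in\mathcal F: B\cup\{x_B\}\subseteq F\}$ and $\mathcal E_B=\{F\setminus\{x_B\}: F\in\mathcal F_B\}$, and let $\mathcal E=\bigcup_{B\in\mathcal B_1}\mathcal E_B$. Then: (1) If $F\in\mathcal F$, $B\in\mathcal B_1$ and $E\in\mathcal E_B$ satisfy $E\subseteq F$, then $F=E\cup\{x_B\}$. (2) For $B\ne B'\in\mathcal B_1$ with $x_B\ne x_{B'}$, we have $\mathcal E_B\cap\mathcal E_{B'}=\varnothing$. (3) For $B,B'\in\mathcal B_1$ let $\mathcal U(B,B')=\{E\in\binom{[n]}{d}: B\cup B'\subseteq E,\ x_B\notin E,\ x_{B'}\notin E\}$. Then $\mathcal U(B,B')\cap\mathcal E=\varnothing$ for all $B,B'\in\mathcal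 B_1$ with $x_B\neq x_{B'}$.
   Context: $[n]=\{1,\dots,n\}$, $\binom{X}{k}$ is the family of $k$-subsets of $X$. A family $\mathcal F\subseteq\binom{[n]}{d+1}$ is an $s$-witness family if for every $F\in\mathcal F$ there exists $B_F\subseteq F$ with $|B_F|=s$ such that $F\cap F'\neq B_F$ for every $F'\in\mathcal F$; here one such $B_F$ is fixed for each $F$. Since $\mathcal A_B$ is intersecting, at most one singleton lies in $\mathcal A_B$, so $x_B$ is well defined. -}

module Defs where

open import Data.Nat using (ℕ; suc; _+_; _∸_; _≤_)
open import Data.Fin using (Fin)
open import Data.Fin.Subset using (Subset; _∈_; _∉_; _⊆_; _∩_; _∪_; _─_; ⁅_⁆; ∁; ∣_∣; Nonempty)
open import Data.Product using (Σ; ∃; _×_)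
open import Relation.Binary.PropositionalEquality using (_≡_; _≢_)

Family : ℕ → Set₁
Family n = Subset n → Set

Uniform : ∀ {n} → ℕ → Family n → Set
Uniform k 𝓕 = ∀ F → 𝓕 F → ∣ F ∣ ≡ k

IsWitnessFamily : ∀ {n} → ℕ → Family n → (Subset n → Subset n) → Set
IsWitnessFamily s 𝓕 W =
  ∀ F → 𝓕 F →
    (W F ⊆ F) × (∣ W F ∣ ≡ s) × (∀ F' → 𝓕 F' → F ∩ F' ≢ W F)

InWitnesses : ∀ {n} → Family n → (Subset n → Subset n) → Subset n → Set
InWitnesses 𝓕 W B = ∃ λ F → 𝓕 F × (W F ≡ B)

-- intersecting family (every two members, not necessarily distinct, meet)
Intersecting : ∀ {n} → Family n → Set
Intersecting 𝓐 = ∀ A A' → 𝓐 A → 𝓐 A' → Nonempty (A ∩ A')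

GoodCovers : ∀ {n} → ℕ → ℕ → Family n → (Subset n → Subset n)
             → (Subset n → Family n) → Set
GoodCovers d s 𝓕 W 𝓐 =
  ∀ B → InWitnesses 𝓕 W B →
    (∀ A → 𝓐 B A → (A ⊆ ∁ B) × (∣ A ∣ ≤ suc d ∸ s))
    × Intersecting (𝓐 B)
    × (∀ F → 𝓕 F → W F ≡ B → ∃ λ A → 𝓐 B A × (A ⊆ F))
    × (∀ F → 𝓕 F → B ⊆ F → ∀ A → 𝓐 B A → Nonempty (A ∩ F))

-- B ∈ 𝓑₁ with x = x_B, i.e. B ∈ 𝓑 and {x} ∈ 𝓐_B
-- (x_B is unique since 𝓐_B is intersecting)
InB1With : ∀ {n} → Family n → (Subset n → Subset n) → (Subset n → Family n)
           → Subset n → Fin n → Set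
InB1With 𝓕 W 𝓐 B x = InWitnesses 𝓕 W B × 𝓐 B ⁅ x ⁆

InE : ∀ {n} → Family n → Subset n → Fin n → Subset n → Set
InE 𝓕 B x E = ∃ λ F → 𝓕 F × (B ∪ ⁅ x ⁆ ⊆ F) × (E ≡ F ─ ⁅ x ⁆)

InEAll : ∀ {n} → Family n → (Subset n → Subset n) → (Subset n → Family n)
         → Subset n → Set
InEAll 𝓕 W 𝓐 E = ∃ λ B → ∃ λ x → InB1With 𝓕 W 𝓐 B x × InE 𝓕 B x E

{-# OPTIONS --safe #-}
-- A member of 𝓕 containing B meets every set of 𝓐_B, so it contains x_B when {x_B} ∈ 𝓐_B.
-- A set E ∈ 𝓔_B contains B but not x_B, hence if E = G ∖ {y} with G ∈ 𝓕 then y = x_B.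
-- All three parts reduce to this; part (1) also uses that members of 𝓕 have equal size.
module Submission where

open import Defs
open import Data.Nat using (ℕ; suc; _*_; _≤_)
open import Data.Nat.Properties using (<⇒≢)
open import Data.Fin using (Fin; _≟_)
open import Data.Fin.Subset
  using (Subset; _∈_; _∉_; _⊆_; _∪_; _─_; _-_; ⁅_⁆; ∣_∣; inside; outside)
open import Data.Fin.Subset.Properties
  using ( _∈?_; ⊆-trans; ⊆-antisym; p⊂q⇒∣p∣<∣q∣; x∈⁅x⁆; x∈⁅y⁆⇒x≡y; x∈∁p⇒x∉p; x∈p∩q⁻
        ; p⊆p∪q; q⊆p∪q; x∈p∪q⁻; p─q⊆p; x∈p∧x≢y⇒x∈p-y)
open import Data.Vec.Base using (_∷_; here; there)
open import Data.Product using (_×_; _,_)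
open import Data.Sum using (inj₁; inj₂)
open import Data.Empty using (⊥)
open import Relation.Nullary using (yes; no; contradiction)
open import Relation.Binary.PropositionalEquality using (_≡_; _≢_; refl; sym; trans; subst)

private
  variable
    n : ℕ
    x y : Fin n
    p q : Subset n

x∈p─q⇒x∉q : x ∈ p ─ q → x ∉ q
x∈p─q⇒x∉q {p = inside ∷ _} {q = outside ∷ _} here ()
x∈p─q⇒x∉q {p = _ ∷ _} {q = _ ∷ _} (there x∈p─q) (there x∈q) = x∈p─q⇒x∉q x∈p─q x∈q

x∉p-x : x ∉ p - x
x∉p-x {x = x} x∈p-x = x∈p─q⇒x∉q x∈p-x (x∈⁅x⁆ x)

x∈p∧x∉p-y⇒x≡y : x ∈ p → x ∉ p - y → x ≡ y
x∈p∧x∉p-y⇒x≡y {x = x} {y = y} x∈p x∉p-y with x ≟ y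
... | yes x≡y = x≡y
... | no  x≢y = contradiction (x∈p∧x≢y⇒x∈p-y x∈p x≢y) x∉p-y

x∈p⇒p-x∪⁅x⁆≡p : x ∈ p → (p - x) ∪ ⁅ x ⁆ ≡ p
x∈p⇒p-x∪⁅x⁆≡p {x = x} {p = p} x∈p = ⊆-antisym ⊆p p⊆
  where
  ⊆p : (p - x) ∪ ⁅ x ⁆ ⊆ p
  ⊆p {y} y∈ with x∈p∪q⁻ (p - x) ⁅ x ⁆ y∈
  ... | inj₁ y∈p-x = p─q⊆p p ⁅ x ⁆ y∈p-x
  ... | inj₂ y∈⁅x⁆ = subst (_∈ p) (sym (x∈⁅y⁆⇒x≡y x y∈⁅x⁆)) x∈p

  p⊆ : p ⊆ (p - x) ∪ ⁅ x ⁆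
  p⊆ {y} y∈p with y ≟ x
  ... | yes refl = q⊆p∪q (p - x) ⁅ x ⁆ (x∈⁅x⁆ x)
  ... | no  y≢x  = p⊆p∪q ⁅ x ⁆ (x∈p∧x≢y⇒x∈p-y y∈p y≢x)

p⊆q∧∣p∣≡∣q∣⇒p≡q : p ⊆ q → ∣ p ∣ ≡ ∣ q ∣ → p ≡ q
p⊆q∧∣p∣≡∣q∣⇒p≡q {p = p} {q = q} p⊆q ∣p∣≡∣q∣ = ⊆-antisym p⊆q q⊆p
  where
  q⊆p : q ⊆ p
  q⊆p {x} x∈q with x ∈? p
  ... | yes x∈p = x∈p
  ... | no  x∉p = contradiction ∣p∣≡∣q∣ (<⇒≢ (p⊂q⇒∣p∣<∣q∣ (p⊆q , x , x∈q , x∉p)))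

module WithGoodCovers
  {n d s : ℕ} {𝓕 : Family n} {W : Subset n → Subset n} {𝓐 : Subset n → Family n}
  (covers : GoodCovers d s 𝓕 W 𝓐) where

  private
    variable
      B B' : Subset n
      E F : Subset n

  InB1With∧⊆⇒∈ : InB1With 𝓕 W 𝓐 B x → 𝓕 F → B ⊆ F → x ∈ F
  InB1With∧⊆⇒∈ {B} {x} {F} (B∈𝓑 , ⁅x⁆∈𝓐B) F∈𝓕 B⊆F
    with _ , _ , _ , meets ← covers B B∈𝓑
    with y , y∈⁅x⁆∩F ← meets F F∈𝓕 B⊆F ⁅ x ⁆ ⁅x⁆∈𝓐B
    with y∈⁅x⁆ , y∈F ← x∈p∩q⁻ ⁅ x ⁆ F y∈⁅x⁆∩F
    = subst (_∈ F) (x∈⁅y⁆⇒x≡y x y∈⁅x⁆) y∈F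

  InB1With⇒∉ : InB1With 𝓕 W 𝓐 B x → x ∉ B
  InB1With⇒∉ {B} {x} (B∈𝓑 , ⁅x⁆∈𝓐B)
    with avoids , _ ← covers B B∈𝓑
    with ⁅x⁆⊆∁B , _ ← avoids ⁅ x ⁆ ⁅x⁆∈𝓐B
    = x∈∁p⇒x∉p (⁅x⁆⊆∁B (x∈⁅x⁆ x))

  InE⇒⊇ : InB1With 𝓕 W 𝓐 B x → InE 𝓕 B x E → B ⊆ E
  InE⇒⊇ {B} {x} B∈𝓑₁ (F , _ , B∪⁅x⁆⊆F , refl) {y} y∈B =
    x∈p∧x≢y⇒x∈p-y (B∪⁅x⁆⊆F (p⊆p∪q ⁅ x ⁆ y∈B)) y≢x
    where
    y≢x : y ≢ x
    y≢x refl = InB1With⇒∉ B∈𝓑₁ y∈B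

  InB1With⇒x≡removed-point : InB1With 𝓕 W 𝓐 B x → 𝓕 F → E ≡ F - y → B ⊆ E → x ∉ E → x ≡ y
  InB1With⇒x≡removed-point {F = F} {y = y} B∈𝓑₁ F∈𝓕 refl B⊆E x∉E =
    x∈p∧x∉p-y⇒x≡y (InB1With∧⊆⇒∈ B∈𝓑₁ F∈𝓕 (⊆-trans B⊆E (p─q⊆p F ⁅ y ⁆))) x∉E

  InE∧⊆⇒≡∪⁅x⁆ : Uniform (suc d) 𝓕 → 𝓕 F → InB1With 𝓕 W 𝓐 B x → InE 𝓕 B x E → E ⊆ F
              → F ≡ E ∪ ⁅ x ⁆
  InE∧⊆⇒≡∪⁅x⁆ {F} {B} {x} uniform F∈𝓕 B∈𝓑₁ E∈𝓔@(G , G∈𝓕 , B∪⁅x⁆⊆G , refl) E⊆F =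
    trans (sym G≡F) G≡E∪⁅x⁆
    where
    G≡E∪⁅x⁆ : G ≡ (G - x) ∪ ⁅ x ⁆
    G≡E∪⁅x⁆ = sym (x∈p⇒p-x∪⁅x⁆≡p (B∪⁅x⁆⊆G (q⊆p∪q B ⁅ x ⁆ (x∈⁅x⁆ x))))

    x∈F : x ∈ F
    x∈F = InB1With∧⊆⇒∈ B∈𝓑₁ F∈𝓕 (⊆-trans (InE⇒⊇ B∈𝓑₁ E∈𝓔) E⊆F)

    G⊆F : G ⊆ F
    G⊆F y∈G with x∈p∪q⁻ (G - x) ⁅ x ⁆ (subst (_ ∈_) G≡E∪⁅x⁆ y∈G)
    ... | inj₁ y∈E    = E⊆F y∈E
    ... | inj₂ y∈⁅x⁆ = subst (_∈ F) (sym (x∈⁅y⁆⇒x≡y x y∈⁅x⁆)) x∈F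

    G≡F : G ≡ F
    G≡F = p⊆q∧∣p∣≡∣q∣⇒p≡q G⊆F (trans (uniform G G∈𝓕) (sym (uniform F F∈𝓕)))

  𝓔-disjoint : InB1With 𝓕 W 𝓐 B x → x ≢ y → InE 𝓕 B x E → InE 𝓕 B' y E → ⊥
  𝓔-disjoint B∈𝓑₁ x≢y E∈𝓔B@(_ , _ , _ , refl) (G , G∈𝓕 , _ , E≡G-y) =
    x≢y (InB1With⇒x≡removed-point B∈𝓑₁ G∈𝓕 E≡G-y (InE⇒⊇ B∈𝓑₁ E∈𝓔B) x∉p-x)

  𝓤∩𝓔≡∅ : InB1With 𝓕 W 𝓐 B x → InB1With 𝓕 W 𝓐 B' y → x ≢ y
        → B ∪ B' ⊆ E → x ∉ E → y ∉ E → InEAll 𝓕 W 𝓐 E → ⊥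
  𝓤∩𝓔≡∅ {B} {B' = B'} B∈𝓑₁ B'∈𝓑₁ x≢y B∪B'⊆E x∉E y∉E (_ , _ , _ , G , G∈𝓕 , _ , E≡G-z) =
    x≢y (trans (InB1With⇒x≡removed-point B∈𝓑₁ G∈𝓕 E≡G-z (⊆-trans (p⊆p∪q B') B∪B'⊆E) x∉E)
          (sym (InB1With⇒x≡removed-point B'∈𝓑₁ G∈𝓕 E≡G-z (⊆-trans (q⊆p∪q B B') B∪B'⊆E) y∉E)))

lemma2p4 : (n d s : ℕ) → 1 ≤ s → 2 * s ≤ d → suc d ≤ n
    → (𝓕 : Family n) → (W : Subset n → Subset n) → (𝓐 : Subset n → Family n)
    → Uniform (suc d) 𝓕 → IsWitnessFamily s 𝓕 W → GoodCovers d s 𝓕 W 𝓐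
    → (∀ F B x E → 𝓕 F → InB1With 𝓕 W 𝓐 B x → InE 𝓕 B x E → E ⊆ F
         → F ≡ E ∪ ⁅ x ⁆)
      × (∀ B B' x x' E → InB1With 𝓕 W 𝓐 B x → InB1With 𝓕 W 𝓐 B' x'
           → B ≢ B' → x ≢ x' → InE 𝓕 B x E → InE 𝓕 B' x' E → ⊥)
      × (∀ B B' x x' E → InB1With 𝓕 W 𝓐 B x → InB1With 𝓕 W 𝓐 B' x'
           → x ≢ x' → ∣ E ∣ ≡ d → B ∪ B' ⊆ E → x ∉ E → x' ∉ E
           → InEAll 𝓕 W 𝓐 E → ⊥)
lemma2p4 n d s _ _ _ 𝓕 W 𝓐 uniform _ covers =
    (λ _ _ _ _ → InE∧⊆⇒≡∪⁅x⁆ uniform)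
  , (λ _ _ _ _ _ B∈𝓑₁ _ _ → 𝓔-disjoint B∈𝓑₁)
  , (λ _ _ _ _ _ B∈𝓑₁ B'∈𝓑₁ x≢x' _ → 𝓤∩𝓔≡∅ B∈𝓑₁ B'∈𝓑₁ x≢x')
  where open WithGoodCovers {d = d} {s = s} covers
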